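{- Let $p$ be a prime and $k\geq 1$ an integer, and let $\mathbb Z_{p^k}=\mathbb Z/p^k\mathbb Z$. Then: (1) the graph $\mathrm{B}(\mathbb Z_{p^k})$ has exactly $p^{2k}+p^{2k-1}+p^{2k-2}$ vertices; (2) the maximum degree of $\mathrm{B}(\mathbb Z_{p^k})$ is $p^k+p^{k-1}$; (3) the diameter of $\mathrm{B}(\mathbb Z_{p^k})$ is $2$.
   Context: For a commutative ring $R$ with unity, let $R^*$ be its group of units, and for $\mathbf v=(v_1,v_2,v_3),\mathbf w=(w_1,w_2,w_3)\in R^3$ let $\mathbf v\cdot\mathbf w = v_1w_1+v_2w_2+v_3w_3$. The graph $\mathrm{B}(R)$ is the simple undirected graph whose vertex set is $\bigl(R^3 \setminus \{\mathbf v \in R^3 : r\mathbf v = \mathbf 0 \text{ for some } r \in R,\ r\neq 0\}\bigr)/\sim$, where $\mathbf v \sim \mathbf w$ iff $k\mathbf v = \mathbf w$ for some $k \in R^*$; two distinct vertices $[\mathbf v]$ and $[\mathbf w]$ are adjacent iff $\mathbf v\cdot\mathbf w = 0$ (this does not depend on the choice of representatives). The maximum degree of a graph is the largest number of neighbours of a vertex; the diameter is the maximum over all pairs of vertices of the length of a shortest path between them. -}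

module Defs where

open import Data.Nat using (ℕ; zero; suc; _+_; _*_; _≤_; NonZero)
open import Data.Nat.DivMod using (_mod_)
open import Data.Nat.Properties using (m^n≢0)
open import Data.Nat.Primality using (Prime; prime⇒nonZero)
open import Data.Nat using (_^_)
open import Data.Fin using (Fin; toℕ)
open import Data.Product using (Σ; ∃; _×_; _,_)
open import Relation.Nullary using (¬_)
open import Relation.Binary.PropositionalEquality using (_≡_)

-- Cardinality of a "subquotient": the set { a : A | P a } modulo the equivalence _∼_
-- has exactly N elements, witnessed by a bijection Fin N → ({a | P a} / ∼).
CardQ : (A : Set) (_∼_ : A → A → Set) (P : A → Set) (N : ℕ) → Set
CardQ A _∼_ P N =
  Σ (Fin N → A) λ f →
    ((i : Fin N) → P (f i)) ×
    ((i j : Fin N) → f i ∼ f j → i ≡ j) ×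
    ((a : A) → P a → ∃ λ i → a ∼ f i)

module ZMod (m : ℕ) .{{_ : NonZero m}} where

  R : Set
  R = Fin m

  0R : R
  0R = 0 mod m

  1R : R
  1R = 1 mod m

  _+R_ : R → R → R
  a +R b = (toℕ a + toℕ b) mod m

  _*R_ : R → R → R
  a *R b = (toℕ a * toℕ b) mod m

  IsUnit : R → Set
  IsUnit u = ∃ λ v → u *R v ≡ 1R

  R3 : Set
  R3 = R × R × R

  0v : R3
  0v = 0R , 0R , 0R

  _·s_ : R → R3 → R3
  r ·s (v₁ , v₂ , v₃) = r *R v₁ , r *R v₂ , r *R v₃

  dot : R3 → R3 → R
  dot (v₁ , v₂ , v₃) (w₁ , w₂ , w₃) = ((v₁ *R w₁) +R (v₂ *R w₂)) +R (v₃ *R w₃)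

  -- v is a representative of a vertex: no nonzero r ∈ R with r v = 0
  IsVertex : R3 → Set
  IsVertex v = ¬ (∃ λ r → ¬ (r ≡ 0R) × (r ·s v ≡ 0v))

  _∼_ : R3 → R3 → Set
  v ∼ w = ∃ λ k → IsUnit k × (k ·s v ≡ w)

  Adj : R3 → R3 → Set
  Adj v w = IsVertex v × IsVertex w × ¬ (v ∼ w) × (dot v w ≡ 0R)

  data Walk (u v : R3) : ℕ → Set where
    here : u ∼ v → Walk u v 0
    step : ∀ {w n} → Adj u w → Walk w v n → Walk u v (suc n)

  Dist : R3 → R3 → ℕ → Set
  Dist u v n = Walk u v n × ((l : ℕ) → Walk u v l → n ≤ l)

  VertexCount : ℕ → Set
  VertexCount N = CardQ R3 _∼_ IsVertex N

  Degree : R3 → ℕ → Set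
  Degree v d = CardQ R3 _∼_ (Adj v) d

  MaxDegree : ℕ → Set
  MaxDegree D =
    ((v : R3) → IsVertex v → (d : ℕ) → Degree v d → d ≤ D) ×
    (∃ λ v → IsVertex v × Degree v D)

  Diameter : ℕ → Set
  Diameter D =
    ((u v : R3) → IsVertex u → IsVertex v → ∃ λ n → Dist u v n × n ≤ D) ×
    (∃ λ u → ∃ λ v → IsVertex u × IsVertex v × Dist u v D)

pk-nonZero : (p k : ℕ) → Prime p → NonZero (p ^ k)
pk-nonZero p k pr = m^n≢0 p k {{prime⇒nonZero pr}}

module Submission where

-- Write m = p^k and q = p^(k-1).  The ring ℤ/m is local: its non-units are
-- exactly the multiples of p, and these form the ideal pR ≅ Fin q.  Hence a
-- triple is a vertex iff one of its coordinates is a unit, and every vertex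
-- class has exactly one representative of the shape (1,a,b), (pc,1,b) or
-- (pc,pd,1); this gives m² + qm + q² vertices.  The neighbours of a vertex
-- with a unit first coordinate α are determined, up to units, by their last
-- two coordinates, which form a point of the projective line (m + q points);
-- (1,0,0) attains this bound.  Finally two linear forms, one of which has a
-- unit coefficient, always have a common zero with a unit coordinate, so any
-- two vertices have a common neighbour and the diameter is 2.

open import Defs
open import Data.Nat using (ℕ; zero; suc; _+_; _*_; _∸_; _^_; _≤_; _<_; NonZero; _%_; z≤n; s≤s; >-nonZero⁻¹; ≢-nonZero⁻¹; nonTrivial⇒n>1)
import Data.Nat as ℕ
import Data.Nat.Properties as ℕP
open import Data.Nat.DivMod using (_mod_; _/_; %-distribˡ-+; %-distribˡ-*; m%n%n≡m%n; m<n⇒m%n≡m; n%n≡0; [m+kn]%n≡m%n; m*n%n≡0; m/n*n≡m)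
open import Data.Nat.Divisibility using (_∣_; divides; _∣?_; ∣m∣n⇒∣m+n; ∣n⇒∣m*n; m∣m*n; %-presˡ-∣; ∣n∣m%n⇒∣m; ∣1⇒≡1; ∣-trans)
open import Data.Nat.GCD using (gcd; gcd[m,n]∣m; gcd[m,n]∣n; gcd[m,n]≡0⇒m≡0; module Bézout)
open import Data.Nat.Coprimality using (Coprime; coprime-Bézout; coprime-divisor; coprime-/gcd)
open import Data.Nat.Primality using (Prime; prime⇒nonZero; prime⇒nonTrivial; euclidsLemma; prime⇒irreducible)
open import Data.Nat.Tactic.RingSolver using (solve-∀)
open import Data.Fin using (Fin; toℕ; fromℕ<)
import Data.Fin.Properties as FinP
open import Data.Product using (_×_; _,_; proj₁; proj₂; Σ; ∃)
import Data.Product.Properties as ProductP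
open import Data.Sum using (_⊎_; inj₁; inj₂)
open import Data.Empty using (⊥-elim)
open import Function using (_∘_)
open import Relation.Nullary using (¬_; Dec; yes; no)
open import Relation.Nullary.Decidable using (¬?; _×-dec_)
open import Relation.Binary.PropositionalEquality
open import Function.Bundles using (_↔_; Inverse)
open import Function.Properties.Inverse using (↔-refl; ↔-trans)
open import Data.Sum.Function.Propositional using (_⊎-↔_)
open import Data.Product.Function.NonDependent.Propositional using (_×-↔_)
open import Algebra.Bundles using (CommutativeRing)
open import Algebra.Consequences.Propositional using (comm∧idˡ⇒id; comm∧invˡ⇒inv; comm∧distrˡ⇒distrʳ)
import Algebra.Properties.Ring as RingProperties
import Algebra.Solver.Ring.NaturalCoefficients.Default as SemiringSolver

module ModularRing (m : ℕ) .{{_ : NonZero m}} where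
  open ZMod m
  open ≡-Reasoning

  toℕ-mod : ∀ n → toℕ (n mod m) ≡ n % m
  toℕ-mod n = FinP.toℕ-fromℕ< _

  toℕ%m : (x : R) → toℕ x % m ≡ toℕ x
  toℕ%m x = m<n⇒m%n≡m (FinP.toℕ<n x)

  0%m : 0 % m ≡ 0
  0%m = m<n⇒m%n≡m (>-nonZero⁻¹ m)

  module Descend (_∙_ : ℕ → ℕ → ℕ)
    (%-distrib : ∀ a b → (a ∙ b) % m ≡ ((a % m) ∙ (b % m)) % m) where

    _⊙_ : R → R → R
    x ⊙ y = (toℕ x ∙ toℕ y) mod m

    %-absorbˡ : ∀ a b → ((a % m) ∙ b) % m ≡ (a ∙ b) % m
    %-absorbˡ a b = begin
      ((a % m) ∙ b) % m           ≡⟨ %-distrib (a % m) b ⟩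
      ((a % m % m) ∙ (b % m)) % m ≡⟨ cong (λ t → (t ∙ (b % m)) % m) (m%n%n≡m%n a m) ⟩
      ((a % m) ∙ (b % m)) % m     ≡⟨ %-distrib a b ⟨
      (a ∙ b) % m                 ∎

    %-absorbʳ : ∀ a b → (a ∙ (b % m)) % m ≡ (a ∙ b) % m
    %-absorbʳ a b = begin
      (a ∙ (b % m)) % m           ≡⟨ %-distrib a (b % m) ⟩
      ((a % m) ∙ (b % m % m)) % m ≡⟨ cong (λ t → ((a % m) ∙ t) % m) (m%n%n≡m%n b m) ⟩
      ((a % m) ∙ (b % m)) % m     ≡⟨ %-distrib a b ⟨
      (a ∙ b) % m                 ∎

    assoc : (∀ a b c → (a ∙ b) ∙ c ≡ a ∙ (b ∙ c)) → ∀ x y z → (x ⊙ y) ⊙ z ≡ x ⊙ (y ⊙ z)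
    assoc ∙-assoc x y z = FinP.toℕ-injective (begin
      toℕ ((x ⊙ y) ⊙ z)       ≡⟨ toℕ-mod _ ⟩
      (toℕ (x ⊙ y) ∙ Z) % m   ≡⟨ cong (λ t → (t ∙ Z) % m) (toℕ-mod _) ⟩
      (((X ∙ Y) % m) ∙ Z) % m ≡⟨ %-absorbˡ (X ∙ Y) Z ⟩
      ((X ∙ Y) ∙ Z) % m       ≡⟨ cong (_% m) (∙-assoc X Y Z) ⟩
      (X ∙ (Y ∙ Z)) % m       ≡⟨ %-absorbʳ X (Y ∙ Z) ⟨
      (X ∙ ((Y ∙ Z) % m)) % m ≡⟨ cong (λ t → (X ∙ t) % m) (toℕ-mod _) ⟨
      (X ∙ toℕ (y ⊙ z)) % m   ≡⟨ toℕ-mod _ ⟨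
      toℕ (x ⊙ (y ⊙ z))       ∎)
      where X = toℕ x; Y = toℕ y; Z = toℕ z

    comm : (∀ a b → a ∙ b ≡ b ∙ a) → ∀ x y → x ⊙ y ≡ y ⊙ x
    comm ∙-comm x y = cong (_mod m) (∙-comm (toℕ x) (toℕ y))

    identityˡ : ∀ e → (∀ a → e ∙ a ≡ a) → ∀ x → (e mod m) ⊙ x ≡ x
    identityˡ e ∙-identity x = FinP.toℕ-injective (begin
      toℕ ((e mod m) ⊙ x)     ≡⟨ toℕ-mod _ ⟩
      (toℕ (e mod m) ∙ X) % m ≡⟨ cong (λ t → (t ∙ X) % m) (toℕ-mod e) ⟩
      ((e % m) ∙ X) % m       ≡⟨ %-absorbˡ e X ⟩
      (e ∙ X) % m             ≡⟨ cong (_% m) (∙-identity X) ⟩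
      X % m                   ≡⟨ toℕ%m x ⟩
      X                       ∎)
      where X = toℕ x

  open Descend _+_ (λ a b → %-distribˡ-+ a b m) using ()
    renaming (assoc to +-assoc′; comm to +-comm′; identityˡ to +-identityˡ; %-absorbˡ to +-absorbˡ)
  open Descend _*_ (λ a b → %-distribˡ-* a b m) using ()
    renaming (assoc to *-assoc′; comm to *-comm′; identityˡ to *-identityˡ; %-absorbʳ to *-absorbʳ)

  +-assoc : ∀ x y z → (x +R y) +R z ≡ x +R (y +R z)
  +-assoc = +-assoc′ ℕP.+-assoc

  +-comm : ∀ x y → x +R y ≡ y +R x
  +-comm = +-comm′ ℕP.+-comm

  *-assoc : ∀ x y z → (x *R y) *R z ≡ x *R (y *R z)
  *-assoc = *-assoc′ ℕP.*-assoc

  *-comm : ∀ x y → x *R y ≡ y *R x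
  *-comm = *-comm′ ℕP.*-comm

  *-mod : ∀ x n → x *R (n mod m) ≡ (toℕ x * n) mod m
  *-mod x n = FinP.toℕ-injective (begin
    toℕ (x *R (n mod m))           ≡⟨ toℕ-mod _ ⟩
    (toℕ x * toℕ (n mod m)) % m    ≡⟨ cong (λ t → (toℕ x * t) % m) (toℕ-mod n) ⟩
    (toℕ x * (n % m)) % m          ≡⟨ *-absorbʳ (toℕ x) n ⟩
    (toℕ x * n) % m                ≡⟨ toℕ-mod _ ⟨
    toℕ ((toℕ x * n) mod m)        ∎)

  mod-cong : ∀ {a b} → a % m ≡ b % m → a mod m ≡ b mod m
  mod-cong {a} {b} eq = FinP.toℕ-injective (trans (toℕ-mod a) (trans eq (sym (toℕ-mod b))))

  +-mod : ∀ a b → (a mod m) +R (b mod m) ≡ (a + b) mod m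
  +-mod a b = mod-cong (begin
    (toℕ (a mod m) + toℕ (b mod m)) % m  ≡⟨ cong₂ (λ s t → (s + t) % m) (toℕ-mod a) (toℕ-mod b) ⟩
    (a % m + b % m) % m                  ≡⟨ %-distribˡ-+ a b m ⟨
    (a + b) % m                          ∎)

  infix 8 -R_
  -R_ : R → R
  -R x = (m ∸ toℕ x) mod m

  -R-inverseˡ : ∀ x → (-R x) +R x ≡ 0R
  -R-inverseˡ x = FinP.toℕ-injective (begin
    toℕ ((-R x) +R x)        ≡⟨ toℕ-mod _ ⟩
    (toℕ (-R x) + X) % m     ≡⟨ cong (λ t → (t + X) % m) (toℕ-mod _) ⟩
    ((m ∸ X) % m + X) % m    ≡⟨ +-absorbˡ (m ∸ X) X ⟩
    (m ∸ X + X) % m          ≡⟨ cong (_% m) (ℕP.m∸n+n≡m (ℕP.<⇒≤ (FinP.toℕ<n x))) ⟩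
    m % m                    ≡⟨ n%n≡0 m ⟩
    0                        ≡⟨ 0%m ⟨
    0 % m                    ≡⟨ toℕ-mod 0 ⟨
    toℕ 0R                   ∎)
    where X = toℕ x

  *-distribˡ-+ : ∀ x y z → x *R (y +R z) ≡ (x *R y) +R (x *R z)
  *-distribˡ-+ x y z = FinP.toℕ-injective (begin
    toℕ (x *R (y +R z))                 ≡⟨ toℕ-mod _ ⟩
    (X * toℕ (y +R z)) % m              ≡⟨ cong (λ t → (X * t) % m) (toℕ-mod _) ⟩
    (X * ((Y + Z) % m)) % m             ≡⟨ *-absorbʳ X (Y + Z) ⟩
    (X * (Y + Z)) % m                   ≡⟨ cong (_% m) (ℕP.*-distribˡ-+ X Y Z) ⟩
    (X * Y + X * Z) % m                 ≡⟨ %-distribˡ-+ (X * Y) (X * Z) m ⟩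
    ((X * Y) % m + (X * Z) % m) % m     ≡⟨ cong₂ (λ s t → (s + t) % m) (toℕ-mod _) (toℕ-mod _) ⟨
    (toℕ (x *R y) + toℕ (x *R z)) % m   ≡⟨ toℕ-mod _ ⟨
    toℕ ((x *R y) +R (x *R z))          ∎)
    where X = toℕ x; Y = toℕ y; Z = toℕ z

  commutativeRing : CommutativeRing _ _
  commutativeRing = record
    { Carrier = R ; _≈_ = _≡_ ; _+_ = _+R_ ; _*_ = _*R_ ; -_ = -R_ ; 0# = 0R ; 1# = 1R
    ; isCommutativeRing = record
      { isRing = record
        { +-isAbelianGroup = record
          { isGroup = record
            { isMonoid = record
              { isSemigroup = record
                { isMagma = record { isEquivalence = isEquivalence ; ∙-cong = cong₂ _+R_ }
                ; assoc = +-assoc }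
              ; identity = comm∧idˡ⇒id +-comm (+-identityˡ 0 (λ _ → refl)) }
            ; inverse = comm∧invˡ⇒inv +-comm -R-inverseˡ
            ; ⁻¹-cong = cong -R_ }
          ; comm = +-comm }
        ; *-cong = cong₂ _*R_
        ; *-assoc = *-assoc
        ; *-identity = comm∧idˡ⇒id *-comm (*-identityˡ 1 ℕP.*-identityˡ)
        ; distrib = *-distribˡ-+ , comm∧distrˡ⇒distrʳ *-comm *-distribˡ-+ }
      ; *-comm = *-comm } }

module _ {A : Set} {_∼_ : A → A → Set} {P : A → Set} where

  cardQ-from-representatives : ∀ {I : Set} {N} → Fin N ↔ I → (g : I → A) →
    (∀ ι → P (g ι)) → (∀ ι ι′ → g ι ∼ g ι′ → ι ≡ ι′) →
    (∀ a → P a → ∃ λ ι → a ∼ g ι) → CardQ A _∼_ P N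
  cardQ-from-representatives bij g g-P g-irredundant g-complete =
    (λ i → g (to i)) , (λ i → g-P (to i)) , injective , complete
    where
    open Inverse bij
    injective : ∀ i j → g (to i) ∼ g (to j) → i ≡ j
    injective i j h = trans (sym (strictlyInverseʳ i))
      (trans (cong from (g-irredundant (to i) (to j) h)) (strictlyInverseʳ j))
    complete : ∀ a → P a → ∃ λ i → a ∼ g (to i)
    complete a pa with g-complete a pa
    ... | ι , a∼gι = from ι , subst (λ ι′ → a ∼ g ι′) (sym (strictlyInverseˡ ι)) a∼gι

  cardQ-≤ : ∀ {I : Set} {d n} → CardQ A _∼_ P d → Fin n ↔ I → (h : A → I) →
    (∀ a b → P a → P b → h a ≡ h b → a ∼ b) → d ≤ n
  cardQ-≤ (f , f-P , f-injective , _) bij h h-separates =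
    FinP.injective⇒≤ λ {i} {j} eq → f-injective i j
      (h-separates (f i) (f j) (f-P i) (f-P j) (trans (sym (strictlyInverseˡ _))
        (trans (cong to eq) (strictlyInverseˡ _))))
    where open Inverse bij

  cardQ-transport : ∀ {Q : A → Set} {d} (τ : A → A) → (∀ a → τ (τ a) ≡ a) →
    (∀ {a b} → a ∼ b → τ a ∼ τ b) → (∀ {a} → P a → Q (τ a)) → (∀ {a} → Q a → P (τ a)) →
    CardQ A _∼_ P d → CardQ A _∼_ Q d
  cardQ-transport {Q} τ τ-invol τ-∼ P⇒Q Q⇒P (f , f-P , f-injective , f-complete) =
    (λ i → τ (f i)) , (λ i → P⇒Q (f-P i)) , injective , complete
    where
    untwist : ∀ {a b} → τ (τ a) ∼ τ (τ b) → a ∼ b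
    untwist {a} {b} = subst₂ _∼_ (τ-invol a) (τ-invol b)
    injective : ∀ i j → τ (f i) ∼ τ (f j) → i ≡ j
    injective i j h = f-injective i j (untwist (τ-∼ h))
    complete : ∀ a → Q a → ∃ λ i → a ∼ τ (f i)
    complete a qa with f-complete (τ a) (Q⇒P qa)
    ... | i , τa∼fi = i , subst (_∼ τ (f i)) (τ-invol a) (τ-∼ τa∼fi)

-- From now on m = p^(k+1) = p·q with q = p^k, and R = ℤ/m.

module PrimePower (p k : ℕ) (prime : Prime p) where

  q : ℕ
  q = p ^ k

  m : ℕ
  m = p * q

  instance
    p≢0 : NonZero p
    p≢0 = prime⇒nonZero prime
    q≢0 : NonZero q
    q≢0 = ℕP.m^n≢0 p k
    m≢0 : NonZero m
    m≢0 = pk-nonZero p (suc k) prime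

  open ZMod m hiding (_+R_; _*R_)
  open ZMod m using () renaming (_+R_ to infixl 6 _+R_; _*R_ to infixl 7 _*R_)
  open ModularRing m using (toℕ-mod; 0%m; mod-cong; +-mod; *-mod; -R_; commutativeRing)
  open CommutativeRing commutativeRing
    using (+-comm; +-assoc; +-identityˡ; -‿inverseˡ; -‿inverseʳ;
           *-comm; *-assoc; *-identityˡ; *-identityʳ; zeroʳ; commutativeSemiring; ring)
  open RingProperties ring using (-‿distribˡ-*; -‿distribʳ-*; -‿involutive; +-cancelʳ; +-inverseˡ-unique; -1*x≈-x)
  open SemiringSolver commutativeSemiring using (solve; _:=_; _:+_; _:*_; con)

  p>1 : 1 < p
  p>1 = nonTrivial⇒n>1 p {{prime⇒nonTrivial prime}}

  toℕ0R : toℕ 0R ≡ 0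
  toℕ0R = trans (toℕ-mod 0) 0%m

  toℕ1R : toℕ 1R ≡ 1
  toℕ1R = trans (toℕ-mod 1) (m<n⇒m%n≡m (ℕP.<-≤-trans p>1 (ℕP.m≤m*n p q)))

  1R≢0R : ¬ 1R ≡ 0R
  1R≢0R eq = ≢-nonZero⁻¹ 1 (trans (sym toℕ1R) (trans (cong toℕ eq) toℕ0R))

  multiple-of-m : ∀ c → (c * m) mod m ≡ 0R
  multiple-of-m c = mod-cong (trans (m*n%n≡0 c m) (sym 0%m))

  infix 4 p∣_ p∤_
  p∣_ : R → Set
  p∣ x = p ∣ toℕ x

  p∤_ : R → Set
  p∤ x = ¬ p∣ x

  p∣? : (x : R) → Dec (p∣ x)
  p∣? x = p ∣? toℕ x

  -- Since p ∣ m, divisibility by p survives reduction mod m in both directions.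
  p∣-mod : ∀ {n} → p ∣ n → p∣ (n mod m)
  p∣-mod {n} p∣n = subst (p ∣_) (sym (toℕ-mod n)) (%-presˡ-∣ p∣n (m∣m*n q))

  p∣-mod⁻¹ : ∀ {n} → p∣ (n mod m) → p ∣ n
  p∣-mod⁻¹ {n} p∣n%m = ∣n∣m%n⇒∣m (m∣m*n q) (subst (p ∣_) (toℕ-mod n) p∣n%m)

  p∣0 : p∣ 0R
  p∣0 = subst (p ∣_) (sym toℕ0R) (divides 0 refl)

  p∤1 : p∤ 1R
  p∤1 p∣1 = ℕP.<⇒≢ p>1 (sym (∣1⇒≡1 (subst (p ∣_) toℕ1R p∣1)))

  p∣-+ : ∀ {x y} → p∣ x → p∣ y → p∣ (x +R y)
  p∣-+ p∣x p∣y = p∣-mod (∣m∣n⇒∣m+n p∣x p∣y)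

  p∣-*ʳ : ∀ x {y} → p∣ y → p∣ (x *R y)
  p∣-*ʳ x p∣y = p∣-mod (∣n⇒∣m*n (toℕ x) p∣y)

  p∣-* : ∀ x y → p∣ (x *R y) → p∣ x ⊎ p∣ y
  p∣-* x y p∣xy = euclidsLemma (toℕ x) (toℕ y) prime (p∣-mod⁻¹ p∣xy)

  p∣-neg : ∀ {x} → p∣ x → p∣ (-R x)
  p∣-neg {x} p∣x = subst p∣_ (-1*x≈-x x) (p∣-*ʳ (-R 1R) p∣x)

  p∤-* : ∀ {x y} → p∤ x → p∤ y → p∤ (x *R y)
  p∤-* {x} {y} p∤x p∤y p∣xy with p∣-* x y p∣xy
  ... | inj₁ p∣x = p∤x p∣x
  ... | inj₂ p∣y = p∤y p∣y

  p∤-neg : ∀ {x} → p∤ x → p∤ (-R x)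
  p∤-neg {x} p∤x p∣-x = p∤x (subst p∣_ (-‿involutive x) (p∣-neg p∣-x))

  invertible⇒p∤ : ∀ {u} → IsUnit u → p∤ u
  invertible⇒p∤ {u} (v , uv≡1) p∣u = p∤1 (subst p∣_ uv≡1 (subst p∣_ (*-comm v u) (p∣-*ʳ v p∣u)))

  coprime-to-power : ∀ {n} j → ¬ p ∣ n → Coprime n (p ^ j)
  coprime-to-power zero p∤n (_ , d∣1) = ∣1⇒≡1 d∣1
  coprime-to-power {n} (suc j) p∤n {d} (d∣n , d∣pp^j) =
    coprime-to-power j p∤n (d∣n , coprime-divisor d⊥p d∣pp^j)
    where
    d⊥p : Coprime d p
    d⊥p {e} (e∣d , e∣p) with prime⇒irreducible prime e∣p
    ... | inj₁ e≡1 = e≡1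
    ... | inj₂ refl = ⊥-elim (p∤n (∣-trans e∣d d∣n))

  p∤⇒invertible : ∀ {u} → p∤ u → IsUnit u
  p∤⇒invertible {u} p∤u with coprime-Bézout (coprime-to-power (suc k) p∤u)
  ... | Bézout.+- x y 1+ym≡xu = x mod m , (begin
      u *R (x mod m)          ≡⟨ *-mod u x ⟩
      (toℕ u * x) mod m       ≡⟨ cong (_mod m) (trans (ℕP.*-comm (toℕ u) x) (sym 1+ym≡xu)) ⟩
      (1 + y * m) mod m       ≡⟨ mod-cong ([m+kn]%n≡m%n 1 y m) ⟩
      1R                      ∎)
    where open ≡-Reasoning
  ... | Bézout.-+ x y 1+xu≡ym = -R (x mod m) , (begin
      u *R (-R (x mod m))     ≡⟨ -‿distribʳ-* u (x mod m) ⟨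
      -R (u *R (x mod m))     ≡⟨ cong -R_ (+-inverseˡ-unique (u *R (x mod m)) 1R ux+1≡0) ⟩
      -R (-R 1R)              ≡⟨ -‿involutive 1R ⟩
      1R                      ∎)
    where
    open ≡-Reasoning
    ux+1≡0 : u *R (x mod m) +R 1R ≡ 0R
    ux+1≡0 = begin
      u *R (x mod m) +R 1 mod m     ≡⟨ cong (_+R 1 mod m) (*-mod u x) ⟩
      (toℕ u * x) mod m +R 1 mod m  ≡⟨ +-mod (toℕ u * x) 1 ⟩
      (toℕ u * x + 1) mod m         ≡⟨ cong (_mod m) (trans (ℕP.+-comm _ 1) (trans (cong (1 +_) (ℕP.*-comm (toℕ u) x)) 1+xu≡ym)) ⟩
      (y * m) mod m                 ≡⟨ multiple-of-m y ⟩
      0R                            ∎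

  inv : (u : R) → p∤ u → R
  inv u p∤u = proj₁ (p∤⇒invertible p∤u)

  inv-cancelˡ : ∀ u (p∤u : p∤ u) → inv u p∤u *R u ≡ 1R
  inv-cancelˡ u p∤u = trans (*-comm _ u) (proj₂ (p∤⇒invertible p∤u))

  p∤-inv : ∀ u (p∤u : p∤ u) → p∤ inv u p∤u
  p∤-inv u p∤u = invertible⇒p∤ (u , inv-cancelˡ u p∤u)

  cancel : ∀ {u x y} → p∤ u → u *R x ≡ u *R y → x ≡ y
  cancel {u} {x} {y} p∤u ux≡uy = begin
    x                     ≡⟨ *-identityˡ x ⟨
    1R *R x               ≡⟨ cong (_*R x) (inv-cancelˡ u p∤u) ⟨
    (u⁻¹ *R u) *R x       ≡⟨ *-assoc u⁻¹ u x ⟩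
    u⁻¹ *R (u *R x)       ≡⟨ cong (u⁻¹ *R_) ux≡uy ⟩
    u⁻¹ *R (u *R y)       ≡⟨ *-assoc u⁻¹ u y ⟨
    (u⁻¹ *R u) *R y       ≡⟨ cong (_*R y) (inv-cancelˡ u p∤u) ⟩
    1R *R y               ≡⟨ *-identityˡ y ⟩
    y                     ∎
    where
    open ≡-Reasoning
    u⁻¹ = inv u p∤u

  cancel-0 : ∀ {u x} → p∤ u → u *R x ≡ 0R → x ≡ 0R
  cancel-0 {u} p∤u ux≡0 = cancel p∤u (trans ux≡0 (sym (zeroʳ u)))

  ratio-scales : ∀ {a a′ t t′} (p∤a′ : p∤ a′) → a *R t ≡ a′ *R t′ → (inv a′ p∤a′ *R a) *R t ≡ t′
  ratio-scales {a} {a′} {t} {t′} p∤a′ at≡a′t′ = begin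
    (a′⁻¹ *R a) *R t      ≡⟨ *-assoc a′⁻¹ a t ⟩
    a′⁻¹ *R (a *R t)      ≡⟨ cong (a′⁻¹ *R_) at≡a′t′ ⟩
    a′⁻¹ *R (a′ *R t′)    ≡⟨ *-assoc a′⁻¹ a′ t′ ⟨
    (a′⁻¹ *R a′) *R t′    ≡⟨ cong (_*R t′) (inv-cancelˡ a′ p∤a′) ⟩
    1R *R t′              ≡⟨ *-identityˡ t′ ⟩
    t′                    ∎
    where
    open ≡-Reasoning
    a′⁻¹ = inv a′ p∤a′

  -- The only element u with u·1 = 1 is 1, and scaling by it changes nothing;
  -- this is how unit multiples of normal forms are identified.
  fixes-1 : ∀ u → u *R 1R ≡ 1R → u ≡ 1R
  fixes-1 u u1≡1 = trans (sym (*-identityʳ u)) u1≡1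

  scaled-by-1 : ∀ {u x y} → u ≡ 1R → u *R x ≡ y → x ≡ y
  scaled-by-1 {x = x} refl 1x≡y = trans (sym (*-identityˡ x)) 1x≡y

  qR : R
  qR = q mod m

  qR≢0 : ¬ qR ≡ 0R
  qR≢0 qR≡0 = ≢-nonZero⁻¹ q (begin
      q             ≡⟨ m<n⇒m%n≡m q<m ⟨
      q % m         ≡⟨ toℕ-mod q ⟨
      toℕ qR        ≡⟨ cong toℕ qR≡0 ⟩
      toℕ 0R        ≡⟨ toℕ0R ⟩
      0             ∎)
    where
    open ≡-Reasoning
    q<m : q < m
    q<m = subst (q <_) (ℕP.*-comm q p) (ℕP.m<m*n q p p>1)

  qR-annihilates : ∀ {x} → p∣ x → qR *R x ≡ 0R
  qR-annihilates {x} (divides c x≡cp) = begin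
    qR *R x               ≡⟨ *-comm qR x ⟩
    x *R (q mod m)        ≡⟨ *-mod x q ⟩
    (toℕ x * q) mod m     ≡⟨ cong (λ t → (t * q) mod m) x≡cp ⟩
    (c * p * q) mod m     ≡⟨ cong (_mod m) (ℕP.*-assoc c p q) ⟩
    (c * m) mod m         ≡⟨ multiple-of-m c ⟩
    0R                    ∎
    where open ≡-Reasoning

  p·_ : Fin q → R
  p· c = fromℕ< (ℕP.*-monoʳ-< p (FinP.toℕ<n c))

  toℕ-p· : ∀ c → toℕ (p· c) ≡ p * toℕ c
  toℕ-p· c = FinP.toℕ-fromℕ< _

  p∣p· : ∀ c → p∣ (p· c)
  p∣p· c = subst (p ∣_) (sym (toℕ-p· c)) (m∣m*n (toℕ c))

  p·-injective : ∀ {c c′} → p· c ≡ p· c′ → c ≡ c′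
  p·-injective {c} {c′} eq = FinP.toℕ-injective
    (ℕP.*-cancelˡ-≡ (toℕ c) (toℕ c′) p (trans (sym (toℕ-p· c)) (trans (cong toℕ eq) (toℕ-p· c′))))

  p∣⇒p· : ∀ {x} → p∣ x → Σ (Fin q) λ c → x ≡ p· c
  p∣⇒p· {x} (divides c x≡cp) = fromℕ< c<q , FinP.toℕ-injective (begin
      toℕ x                    ≡⟨ trans x≡cp (ℕP.*-comm c p) ⟩
      p * c                    ≡⟨ cong (p *_) (FinP.toℕ-fromℕ< c<q) ⟨
      p * toℕ (fromℕ< c<q)     ≡⟨ toℕ-p· (fromℕ< c<q) ⟨
      toℕ (p· fromℕ< c<q)      ∎)
    where
    open ≡-Reasoning
    c<q : c < q
    c<q = ℕP.*-cancelˡ-< p c q (subst (_< m) (trans x≡cp (ℕP.*-comm c p)) (FinP.toℕ<n x))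

  first second third : R3 → R
  first  (x , _ , _) = x
  second (_ , y , _) = y
  third  (_ , _ , z) = z

  ·s-identity : ∀ v → 1R ·s v ≡ v
  ·s-identity (x , y , z) = cong₂ _,_ (*-identityˡ x) (cong₂ _,_ (*-identityˡ y) (*-identityˡ z))

  dot-comm : ∀ v w → dot v w ≡ dot w v
  dot-comm (a , b , c) (x , y , z) =
    solve 6 (λ a b c x y z → a :* x :+ b :* y :+ c :* z := x :* a :+ y :* b :+ z :* c) refl a b c x y z

  dot-scaleʳ : ∀ u v w → dot v (u ·s w) ≡ u *R dot v w
  dot-scaleʳ u (a , b , c) (x , y , z) =
    solve 7 (λ u a b c x y z → a :* (u :* x) :+ b :* (u :* y) :+ c :* (u :* z) := u :* (a :* x :+ b :* y :+ c :* z))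
      refl u a b c x y z

  UnitCoord : R3 → Set
  UnitCoord (a , b , c) = p∤ a ⊎ p∤ b ⊎ p∤ c

  unitCoord⇒vertex : ∀ v → UnitCoord v → IsVertex v
  unitCoord⇒vertex (a , b , c) unit (r , r≢0 , rv≡0) = r≢0 (r≡0 unit)
    where
    r≡0 : UnitCoord (a , b , c) → r ≡ 0R
    r≡0 (inj₁ p∤a)        = cancel-0 p∤a (trans (*-comm a r) (cong first rv≡0))
    r≡0 (inj₂ (inj₁ p∤b)) = cancel-0 p∤b (trans (*-comm b r) (cong second rv≡0))
    r≡0 (inj₂ (inj₂ p∤c)) = cancel-0 p∤c (trans (*-comm c r) (cong third rv≡0))

  -- If every coordinate lies in pR, then p^k kills the triple.
  vertex⇒unitCoord : ∀ v → IsVertex v → UnitCoord v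
  vertex⇒unitCoord (a , b , c) vertex with p∣? a | p∣? b | p∣? c
  ... | no p∤a | _      | _      = inj₁ p∤a
  ... | yes _  | no p∤b | _      = inj₂ (inj₁ p∤b)
  ... | yes _  | yes _  | no p∤c = inj₂ (inj₂ p∤c)
  ... | yes p∣a | yes p∣b | yes p∣c = ⊥-elim (vertex (qR , qR≢0 ,
        cong₂ _,_ (qR-annihilates p∣a) (cong₂ _,_ (qR-annihilates p∣b) (qR-annihilates p∣c))))

  -- Normal forms on the projective line: every pair with a unit entry is,
  -- up to a unit, exactly one of (1, b) with b ∈ R or (p·c, 1) with c ∈ Fin q.

  R2 : Set
  R2 = R × R

  _·₂_ : R → R2 → R2
  u ·₂ (a , b) = u *R a , u *R b

  LinePoint : Set
  LinePoint = R ⊎ Fin q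

  line-points↔ : Fin (m + q) ↔ LinePoint
  line-points↔ = FinP.+↔⊎

  linePoint : LinePoint → R2
  linePoint (inj₁ b) = 1R , b
  linePoint (inj₂ c) = p· c , 1R

  -- The normal form of a pair (junk if neither entry is a unit).
  lineNormal : R → R → LinePoint
  lineNormal a b with p∣? a | p∣? b
  ... | no p∤a   | _      = inj₁ (inv a p∤a *R b)
  ... | yes p∣a  | no p∤b = inj₂ (proj₁ (p∣⇒p· (p∣-*ʳ (inv b p∤b) p∣a)))
  ... | yes _    | yes _  = inj₁ 0R

  lineNormal-spec : ∀ a b → p∤ a ⊎ p∤ b →
    Σ R λ u → p∤ u × u ·₂ (a , b) ≡ linePoint (lineNormal a b)
  lineNormal-spec a b unit with p∣? a | p∣? b
  ... | no p∤a  | _      = inv a p∤a , p∤-inv a p∤a , cong₂ _,_ (inv-cancelˡ a p∤a) refl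
  ... | yes p∣a | no p∤b = inv b p∤b , p∤-inv b p∤b ,
        cong₂ _,_ (proj₂ (p∣⇒p· (p∣-*ʳ (inv b p∤b) p∣a))) (inv-cancelˡ b p∤b)
  ... | yes p∣a | yes p∣b with unit
  ...   | inj₁ p∤a = ⊥-elim (p∤a p∣a)
  ...   | inj₂ p∤b = ⊥-elim (p∤b p∣b)

  linePoint-unique : ∀ u ι ι′ → p∤ u → u ·₂ linePoint ι ≡ linePoint ι′ → u ≡ 1R × ι ≡ ι′
  linePoint-unique u (inj₁ b) (inj₁ b′) _ eq = u≡1 , cong inj₁ (scaled-by-1 u≡1 (cong proj₂ eq))
    where u≡1 = fixes-1 u (cong proj₁ eq)
  linePoint-unique u (inj₁ _) (inj₂ c′) p∤u eq =
    ⊥-elim (p∤u (subst p∣_ (trans (sym (cong proj₁ eq)) (*-identityʳ u)) (p∣p· c′)))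
  linePoint-unique u (inj₂ c) (inj₁ _) _ eq = ⊥-elim (p∤1 (subst p∣_ (cong proj₁ eq) (p∣-*ʳ u (p∣p· c))))
  linePoint-unique u (inj₂ c) (inj₂ c′) _ eq = u≡1 , cong inj₂ (p·-injective (scaled-by-1 u≡1 (cong proj₁ eq)))
    where u≡1 = fixes-1 u (cong proj₂ eq)

  -- Normal forms in the plane: (1, a, b) with a, b ∈ R, or (p·c, ι) with
  -- c ∈ Fin q and ι a normal form on the line.

  PlanePoint : Set
  PlanePoint = (R × R) ⊎ (Fin q × LinePoint)

  plane-points↔ : Fin (m * m + q * (m + q)) ↔ PlanePoint
  plane-points↔ = ↔-trans FinP.+↔⊎ (FinP.*↔× ⊎-↔ ↔-trans FinP.*↔× (↔-refl ×-↔ line-points↔))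

  planePoint : PlanePoint → R3
  planePoint (inj₁ (a , b)) = 1R , a , b
  planePoint (inj₂ (c , ι)) = p· c , linePoint ι

  planePoint-unitCoord : ∀ ι → UnitCoord (planePoint ι)
  planePoint-unitCoord (inj₁ _) = inj₁ p∤1
  planePoint-unitCoord (inj₂ (_ , inj₁ _)) = inj₂ (inj₁ p∤1)
  planePoint-unitCoord (inj₂ (_ , inj₂ _)) = inj₂ (inj₂ p∤1)

  planeNormal-spec : ∀ v → UnitCoord v → Σ PlanePoint λ ι → Σ R λ u → p∤ u × u ·s v ≡ planePoint ι
  planeNormal-spec (a , b , c) unit with p∣? a
  ... | no p∤a = inj₁ (inv a p∤a *R b , inv a p∤a *R c) , inv a p∤a , p∤-inv a p∤a ,
        cong₂ _,_ (inv-cancelˡ a p∤a) refl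
  ... | yes p∣a with lineNormal-spec b c (tail-unit unit)
    where
    tail-unit : UnitCoord (a , b , c) → p∤ b ⊎ p∤ c
    tail-unit (inj₁ p∤a) = ⊥-elim (p∤a p∣a)
    tail-unit (inj₂ unit-bc) = unit-bc
  ...   | u , p∤u , u[b,c]≡ι = inj₂ (proj₁ ua , lineNormal b c) , u , p∤u , cong₂ _,_ (proj₂ ua) u[b,c]≡ι
    where ua = p∣⇒p· (p∣-*ʳ u p∣a)

  planePoint-unique : ∀ u ι ι′ → p∤ u → u ·s planePoint ι ≡ planePoint ι′ → ι ≡ ι′
  planePoint-unique u (inj₁ _) (inj₁ _) _ eq =
    cong inj₁ (cong₂ _,_ (scaled-by-1 u≡1 (cong second eq)) (scaled-by-1 u≡1 (cong third eq)))
    where u≡1 = fixes-1 u (cong first eq)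
  planePoint-unique u (inj₁ _) (inj₂ (c′ , _)) p∤u eq =
    ⊥-elim (p∤u (subst p∣_ (trans (sym (cong first eq)) (*-identityʳ u)) (p∣p· c′)))
  planePoint-unique u (inj₂ (c , _)) (inj₁ _) _ eq = ⊥-elim (p∤1 (subst p∣_ (cong first eq) (p∣-*ʳ u (p∣p· c))))
  planePoint-unique u (inj₂ (c , ι)) (inj₂ (c′ , ι′)) p∤u eq
    with linePoint-unique u ι ι′ p∤u (cong (λ v → second v , third v) eq)
  ... | u≡1 , refl = cong (λ c″ → inj₂ (c″ , ι)) (p·-injective (scaled-by-1 u≡1 (cong first eq)))

  vertexCount : VertexCount (m * m + q * (m + q))
  vertexCount = cardQ-from-representatives {_∼_ = _∼_} {P = IsVertex} plane-points↔ planePoint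
    (λ ι → unitCoord⇒vertex _ (planePoint-unitCoord ι))
    (λ ι ι′ (u , u-unit , eq) → planePoint-unique u ι ι′ (invertible⇒p∤ {u} u-unit) eq)
    (λ v vertex → let (ι , u , p∤u , eq) = planeNormal-spec v (vertex⇒unitCoord v vertex)
                  in ι , u , p∤⇒invertible p∤u , eq)

  data Swap : Set where
    keep swap₁₂ swap₁₃ : Swap

  swap : Swap → R3 → R3
  swap keep   v           = v
  swap swap₁₂ (a , b , c) = b , a , c
  swap swap₁₃ (a , b , c) = c , b , a

  swap-involutive : ∀ σ v → swap σ (swap σ v) ≡ v
  swap-involutive keep   _ = refl
  swap-involutive swap₁₂ _ = refl
  swap-involutive swap₁₃ _ = refl

  swap-scale : ∀ σ u v → swap σ (u ·s v) ≡ u ·s swap σ v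
  swap-scale keep   _ _ = refl
  swap-scale swap₁₂ _ _ = refl
  swap-scale swap₁₃ _ _ = refl

  swap-0v : ∀ σ → swap σ 0v ≡ 0v
  swap-0v keep   = refl
  swap-0v swap₁₂ = refl
  swap-0v swap₁₃ = refl

  swap-dot : ∀ σ v w → dot (swap σ v) (swap σ w) ≡ dot v w
  swap-dot keep   _ _ = refl
  swap-dot swap₁₂ (a , b , c) (x , y , z) =
    solve 6 (λ a b c x y z → b :* y :+ a :* x :+ c :* z := a :* x :+ b :* y :+ c :* z) refl a b c x y z
  swap-dot swap₁₃ (a , b , c) (x , y , z) =
    solve 6 (λ a b c x y z → c :* z :+ b :* y :+ a :* x := a :* x :+ b :* y :+ c :* z) refl a b c x y z

  swap-vertex : ∀ σ {v} → IsVertex v → IsVertex (swap σ v)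
  swap-vertex σ {v} vertex (r , r≢0 , rσv≡0) = vertex (r , r≢0 , (begin
      r ·s v                     ≡⟨ swap-involutive σ (r ·s v) ⟨
      swap σ (swap σ (r ·s v))   ≡⟨ cong (swap σ) (swap-scale σ r v) ⟩
      swap σ (r ·s swap σ v)     ≡⟨ cong (swap σ) rσv≡0 ⟩
      swap σ 0v                  ≡⟨ swap-0v σ ⟩
      0v                         ∎))
    where open ≡-Reasoning

  swap-∼ : ∀ σ {v w} → v ∼ w → swap σ v ∼ swap σ w
  swap-∼ σ {v} (u , u-unit , uv≡w) = u , u-unit , trans (sym (swap-scale σ u v)) (cong (swap σ) uv≡w)

  swap-adj : ∀ σ {v w} → Adj v w → Adj (swap σ v) (swap σ w)
  swap-adj σ {v} {w} (vertex-v , vertex-w , v≁w , v·w≡0) =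
    swap-vertex σ vertex-v , swap-vertex σ vertex-w , v≁w ∘ unswap , trans (swap-dot σ v w) v·w≡0
    where
    unswap : swap σ v ∼ swap σ w → v ∼ w
    unswap h = subst₂ _∼_ (swap-involutive σ v) (swap-involutive σ w) (swap-∼ σ h)

  unit-first : ∀ v → UnitCoord v → Σ Swap λ σ → p∤ first (swap σ v)
  unit-first _ (inj₁ p∤a)        = keep , p∤a
  unit-first _ (inj₂ (inj₁ p∤b)) = swap₁₂ , p∤b
  unit-first _ (inj₂ (inj₂ p∤c)) = swap₁₃ , p∤c

  degree-swap : ∀ σ {v d} → Degree v d → Degree (swap σ v) d
  degree-swap σ {v} = cardQ-transport {_∼_ = _∼_} {P = Adj v} {Q = Adj (swap σ v)}
    (swap σ) (swap-involutive σ) (swap-∼ σ) (swap-adj σ)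
    (λ {a} adj → subst (λ v′ → Adj v′ (swap σ a)) (swap-involutive σ v) (swap-adj σ adj))

  zero-determined : ∀ α β γ x x′ y z → p∤ α →
    dot (α , β , γ) (x , y , z) ≡ 0R → dot (α , β , γ) (x′ , y , z) ≡ 0R → x ≡ x′
  zero-determined α β γ x x′ y z p∤α eq eq′ =
    cancel p∤α (+-cancelʳ (β *R y) (α *R x) (α *R x′) (+-cancelʳ (γ *R z) _ _ (trans eq (sym eq′))))

  -- A neighbour of (α, β, γ) with α a unit has a unit among its last two
  -- coordinates: otherwise αx ∈ pR, so x ∈ pR as well.
  neighbour-tail-unit : ∀ v w → p∤ first v → IsVertex w → dot v w ≡ 0R → p∤ second w ⊎ p∤ third w
  neighbour-tail-unit (α , β , γ) (x , y , z) p∤α vertex-w ortho with p∣? y | p∣? z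
  ... | no p∤y  | _       = inj₁ p∤y
  ... | yes _   | no p∤z  = inj₂ p∤z
  ... | yes p∣y | yes p∣z with vertex⇒unitCoord _ vertex-w
  ...   | inj₂ (inj₁ p∤y) = ⊥-elim (p∤y p∣y)
  ...   | inj₂ (inj₂ p∤z) = ⊥-elim (p∤z p∣z)
  ...   | inj₁ p∤x        = ⊥-elim (p∤-* p∤α p∤x p∣αx)
    where
    αx≡-rest : α *R x ≡ -R (β *R y +R γ *R z)
    αx≡-rest = +-inverseˡ-unique (α *R x) _ (trans (sym (+-assoc _ _ _)) ortho)
    p∣αx : p∣ α *R x
    p∣αx = subst p∣_ (sym αx≡-rest) (p∣-neg (p∣-+ (p∣-*ʳ β p∣y) (p∣-*ʳ γ p∣z)))

  -- Neighbours of (α, β, γ), α a unit, with the same normal form of their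
  -- last two coordinates are equivalent; so there are at most m + q of them.
  degree-bound : ∀ v {d} → p∤ first v → Degree v d → d ≤ m + q
  degree-bound v@(α , β , γ) p∤α deg =
    cardQ-≤ {P = Adj v} deg line-points↔ (λ w → lineNormal (second w) (third w)) same-normal⇒∼
    where
    same-normal⇒∼ : ∀ w w′ → Adj v w → Adj v w′ →
      lineNormal (second w) (third w) ≡ lineNormal (second w′) (third w′) → w ∼ w′
    same-normal⇒∼ w@(x , y , z) w′@(x′ , y′ , z′) (_ , vertex-w , _ , ortho) (_ , vertex-w′ , _ , ortho′) same
      with lineNormal-spec y z (neighbour-tail-unit v w p∤α vertex-w ortho)
         | lineNormal-spec y′ z′ (neighbour-tail-unit v w′ p∤α vertex-w′ ortho′)
    ... | a , p∤a , a[y,z]≡ι | a′ , p∤a′ , a′[y′,z′]≡ι′ =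
      u , p∤⇒invertible (p∤-* (p∤-inv a′ p∤a′) p∤a) , cong₂ _,_ ux≡x′ (cong₂ _,_ uy≡y′ uz≡z′)
      where
      u = inv a′ p∤a′ *R a
      same-pair : a ·₂ (y , z) ≡ a′ ·₂ (y′ , z′)
      same-pair = trans a[y,z]≡ι (trans (cong linePoint same) (sym a′[y′,z′]≡ι′))
      uy≡y′ : u *R y ≡ y′
      uy≡y′ = ratio-scales p∤a′ (cong proj₁ same-pair)
      uz≡z′ : u *R z ≡ z′
      uz≡z′ = ratio-scales p∤a′ (cong proj₂ same-pair)
      ortho-uw : dot v (u *R x , y′ , z′) ≡ 0R
      ortho-uw = subst (λ t → dot v (u *R x , t) ≡ 0R) (cong₂ _,_ uy≡y′ uz≡z′)
        (trans (dot-scaleʳ u v w) (trans (cong (u *R_) ortho) (zeroʳ u)))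
      ux≡x′ : u *R x ≡ x′
      ux≡x′ = zero-determined α β γ (u *R x) x′ y′ z′ p∤α ortho-uw ortho′

  e₁ : R3
  e₁ = 1R , 0R , 0R

  e₁-vertex : IsVertex e₁
  e₁-vertex = unitCoord⇒vertex e₁ (inj₁ p∤1)

  dot-e₁ : ∀ w → dot e₁ w ≡ first w
  dot-e₁ (x , y , z) = solve 3 (λ x y z → con 1 :* x :+ con 0 :* y :+ con 0 :* z := x) refl x y z

  -- The neighbours of e₁ are the classes of (0, ι) for ι on the line.
  degree-e₁ : Degree e₁ (m + q)
  degree-e₁ = cardQ-from-representatives {_∼_ = _∼_} {P = Adj e₁} line-points↔ neighbour
    adjacent irredundant complete
    where
    neighbour : LinePoint → R3
    neighbour ι = 0R , linePoint ι
    neighbour-unit : ∀ ι → UnitCoord (neighbour ι)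
    neighbour-unit (inj₁ _) = inj₂ (inj₁ p∤1)
    neighbour-unit (inj₂ _) = inj₂ (inj₂ p∤1)
    e₁≁neighbour : ∀ ι → ¬ e₁ ∼ neighbour ι
    e₁≁neighbour ι (u , u-unit , eq) =
      invertible⇒p∤ {u} u-unit (subst p∣_ (sym (trans (sym (*-identityʳ u)) (cong first eq))) p∣0)
    adjacent : ∀ ι → Adj e₁ (neighbour ι)
    adjacent ι = e₁-vertex , unitCoord⇒vertex _ (neighbour-unit ι) ,
      e₁≁neighbour ι , dot-e₁ (neighbour ι)
    irredundant : ∀ ι ι′ → neighbour ι ∼ neighbour ι′ → ι ≡ ι′
    irredundant ι ι′ (u , u-unit , eq) =
      proj₂ (linePoint-unique u ι ι′ (invertible⇒p∤ {u} u-unit) (cong (λ w → second w , third w) eq))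
    complete : ∀ w → Adj e₁ w → ∃ λ ι → w ∼ neighbour ι
    complete (x , y , z) (_ , vertex-w , _ , ortho)
      with lineNormal-spec y z (neighbour-tail-unit e₁ (x , y , z) p∤1 vertex-w ortho)
    ... | u , p∤u , eq = lineNormal y z , u , p∤⇒invertible p∤u ,
          cong₂ _,_ (trans (cong (u *R_) (trans (sym (dot-e₁ (x , y , z))) ortho)) (zeroʳ u)) eq

  maxDegree : MaxDegree (m + q)
  maxDegree = bounded , e₁ , e₁-vertex , degree-e₁
    where
    bounded : ∀ v → IsVertex v → ∀ d → Degree v d → d ≤ m + q
    bounded v vertex d deg with unit-first v (vertex⇒unitCoord v vertex)
    ... | σ , p∤α = degree-bound (swap σ v) p∤α (degree-swap σ deg)

  -- Every linear form cs + dt has a zero with a unit coordinate: divide the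
  -- zero (d, -c) by the gcd of the representatives of c and d.
  kernel-point : ∀ c d → Σ R λ s → Σ R λ t → c *R s +R d *R t ≡ 0R × (p∤ s ⊎ p∤ t)
  kernel-point c d with gcd (toℕ c) (toℕ d) ℕ.≟ 0
  ... | yes g≡0 = 1R , 0R , (begin
        c *R 1R +R d *R 0R  ≡⟨ cong₂ _+R_ (trans (*-identityʳ c) c≡0) (zeroʳ d) ⟩
        0R +R 0R            ≡⟨ +-identityˡ 0R ⟩
        0R                  ∎) , inj₁ p∤1
    where
    open ≡-Reasoning
    c≡0 : c ≡ 0R
    c≡0 = FinP.toℕ-injective (trans (gcd[m,n]≡0⇒m≡0 g≡0) (sym toℕ0R))
  ... | no g≢0 = D′ mod m , -R (C′ mod m) , (begin
        c *R (D′ mod m) +R d *R (-R (C′ mod m))       ≡⟨ cong (c *R (D′ mod m) +R_) (-‿distribʳ-* d (C′ mod m)) ⟨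
        c *R (D′ mod m) +R -R (d *R (C′ mod m))       ≡⟨ cong₂ (λ s t → s +R -R t) (*-mod c D′) (*-mod d C′) ⟩
        (C * D′) mod m +R -R ((Dn * C′) mod m)        ≡⟨ cong (λ t → (C * D′) mod m +R -R (t mod m)) cross ⟨
        (C * D′) mod m +R -R ((C * D′) mod m)         ≡⟨ -‿inverseʳ _ ⟩
        0R                                            ∎) , unit
    where
    open ≡-Reasoning
    C Dn g : ℕ
    C = toℕ c
    Dn = toℕ d
    g = gcd C Dn
    instance
      g-nonZero : NonZero g
      g-nonZero = ℕ.≢-nonZero g≢0
    C′ D′ : ℕ
    C′ = C / g
    D′ = Dn / g
    rearrange : ∀ a b c → a * b * c ≡ c * b * a
    rearrange = solve-∀
    cross : C * D′ ≡ Dn * C′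
    cross = begin
      C * D′             ≡⟨ cong (_* D′) (m/n*n≡m (gcd[m,n]∣m C Dn)) ⟨
      C′ * g * D′        ≡⟨ rearrange C′ g D′ ⟩
      D′ * g * C′        ≡⟨ cong (_* C′) (m/n*n≡m (gcd[m,n]∣n C Dn)) ⟩
      Dn * C′            ∎
    unit : p∤ (D′ mod m) ⊎ p∤ (-R (C′ mod m))
    unit with p ∣? D′
    ... | no p∤D′  = inj₁ (p∤D′ ∘ p∣-mod⁻¹)
    ... | yes p∣D′ = inj₂ (p∤-neg (p∤C′ ∘ p∣-mod⁻¹))
      where
      p∤C′ : ¬ p ∣ C′
      p∤C′ p∣C′ = ℕP.<⇒≢ p>1 (sym (coprime-/gcd C Dn (p∣C′ , p∣D′)))

  CommonZero : R3 → R3 → Set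
  CommonZero u v = Σ R3 λ w → IsVertex w × dot u w ≡ 0R × dot v w ≡ 0R

  -- Eliminating x from αx + βy + γz = 0 = δx + εy + ζz leaves the form
  -- (αε - δβ) y + (αζ - δγ) z, whose zero (y, z) lifts by x = -α⁻¹(βy + γz).
  common-zero-unit-first : ∀ u v → p∤ first u → CommonZero u v
  common-zero-unit-first (α , β , γ) (δ , ε , ζ) p∤α
    with kernel-point (α *R ε +R (-R δ) *R β) (α *R ζ +R (-R δ) *R γ)
  ... | y , z , kernel , unit-yz = (x , y , z) , unitCoord⇒vertex _ (inj₂ unit-yz) , first-zero , second-zero
    where
    open ≡-Reasoning
    rest : R
    rest = β *R y +R γ *R z
    x : R
    x = inv α p∤α *R (-R rest)
    αx≡-rest : α *R x ≡ -R rest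
    αx≡-rest = begin
      α *R (inv α p∤α *R (-R rest))   ≡⟨ *-assoc α _ _ ⟨
      (α *R inv α p∤α) *R (-R rest)   ≡⟨ cong (_*R (-R rest)) (trans (*-comm α _) (inv-cancelˡ α p∤α)) ⟩
      1R *R (-R rest)                 ≡⟨ *-identityˡ _ ⟩
      -R rest                         ∎
    first-zero : α *R x +R β *R y +R γ *R z ≡ 0R
    first-zero = begin
      α *R x +R β *R y +R γ *R z      ≡⟨ +-assoc _ _ _ ⟩
      α *R x +R rest                  ≡⟨ cong (_+R rest) αx≡-rest ⟩
      -R rest +R rest                 ≡⟨ -‿inverseˡ rest ⟩
      0R                              ∎
    second-zero : δ *R x +R ε *R y +R ζ *R z ≡ 0R
    second-zero = cancel p∤α (begin
      α *R (δ *R x +R ε *R y +R ζ *R z)             ≡⟨ solve 7 (λ α δ x ε y ζ z →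
                                                          α :* (δ :* x :+ ε :* y :+ ζ :* z)
                                                       := δ :* (α :* x) :+ α :* (ε :* y :+ ζ :* z)) refl α δ x ε y ζ z ⟩
      δ *R (α *R x) +R α *R (ε *R y +R ζ *R z)      ≡⟨ cong (λ t → δ *R t +R α *R (ε *R y +R ζ *R z)) αx≡-rest ⟩
      δ *R (-R rest) +R α *R (ε *R y +R ζ *R z)     ≡⟨ cong (_+R α *R (ε *R y +R ζ *R z))
                                                         (trans (sym (-‿distribʳ-* δ rest)) (-‿distribˡ-* δ rest)) ⟩
      (-R δ) *R rest +R α *R (ε *R y +R ζ *R z)     ≡⟨ solve 8 (λ α β γ -δ ε ζ y z →
                                                          -δ :* (β :* y :+ γ :* z) :+ α :* (ε :* y :+ ζ :* z)
                                                       := (α :* ε :+ -δ :* β) :* y :+ (α :* ζ :+ -δ :* γ) :* z)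
                                                       refl α β γ (-R δ) ε ζ y z ⟩
      (α *R ε +R (-R δ) *R β) *R y +R (α *R ζ +R (-R δ) *R γ) *R z  ≡⟨ kernel ⟩
      0R                                            ≡⟨ zeroʳ α ⟨
      α *R 0R                                       ∎)

  common-zero-unswap : ∀ σ u v → CommonZero (swap σ u) (swap σ v) → CommonZero u v
  common-zero-unswap σ u v (w , vertex-w , uw≡0 , vw≡0) =
    swap σ w , swap-vertex σ vertex-w , unswap u uw≡0 , unswap v vw≡0
    where
    unswap : ∀ a → dot (swap σ a) w ≡ 0R → dot a (swap σ w) ≡ 0R
    unswap a eq = trans (sym (swap-dot σ a (swap σ w))) (trans (cong (dot (swap σ a)) (swap-involutive σ w)) eq)

  common-zero : ∀ u v → IsVertex u → CommonZero u v
  common-zero u v vertex-u =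
    let (σ , p∤α) = unit-first u (vertex⇒unitCoord u vertex-u)
    in common-zero-unswap σ u v (common-zero-unit-first (swap σ u) (swap σ v) p∤α)

  ∼-refl : ∀ v → v ∼ v
  ∼-refl v = 1R , (1R , *-identityˡ 1R) , ·s-identity v

  ∼-orthogonal : ∀ a w w′ → dot a w ≡ 0R → w ∼ w′ → dot a w′ ≡ 0R
  ∼-orthogonal a w _ a·w≡0 (u , _ , uw≡w′) =
    trans (cong (dot a) (sym uw≡w′)) (trans (dot-scaleʳ u a w) (trans (cong (u *R_) a·w≡0) (zeroʳ u)))

  ∼-orthogonal⁻¹ : ∀ a w w′ → dot a w′ ≡ 0R → w ∼ w′ → dot a w ≡ 0R
  ∼-orthogonal⁻¹ a w _ a·w′≡0 (u , u-unit , uw≡w′) =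
    cancel-0 (invertible⇒p∤ {u} u-unit) (trans (sym (dot-scaleʳ u a w)) (trans (cong (dot a) uw≡w′) a·w′≡0))

  _≟R3_ : (v w : R3) → Dec (v ≡ w)
  _≟R3_ = ProductP.≡-dec FinP._≟_ (ProductP.≡-dec FinP._≟_ FinP._≟_)

  ∼-dec : ∀ v w → Dec (v ∼ w)
  ∼-dec v w with FinP.any? (λ u → ¬? (p∣? u) ×-dec ((u ·s v) ≟R3 w))
  ... | yes (u , p∤u , uv≡w) = yes (u , p∤⇒invertible p∤u , uv≡w)
  ... | no none = no λ (u , u-unit , uv≡w) → none (u , invertible⇒p∤ {u} u-unit , uv≡w)

  distance-0 : ∀ v w → v ∼ w → Dist v w 0
  distance-0 _ _ v∼w = here v∼w , λ _ _ → z≤n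

  distance-1 : ∀ v w → Adj v w → Dist v w 1
  distance-1 v w adj@(_ , _ , v≁w , _) = step adj (here (∼-refl w)) , shortest
    where
    shortest : ∀ l → Walk v w l → 1 ≤ l
    shortest zero (here v∼w) = ⊥-elim (v≁w v∼w)
    shortest (suc _) _ = s≤s z≤n

  distance-2-via : ∀ v w c → IsVertex v → IsVertex w → IsVertex c → ¬ v ∼ w → ¬ dot v w ≡ 0R →
    dot v c ≡ 0R → dot w c ≡ 0R → Dist v w 2
  distance-2-via v w c vertex-v vertex-w vertex-c v≁w v·w≢0 v·c≡0 w·c≡0 =
    step v-c (step c-w (here (∼-refl w))) , shortest
    where
    v-c : Adj v c
    v-c = vertex-v , vertex-c , (λ v∼c → v·w≢0 (trans (dot-comm v w) (∼-orthogonal⁻¹ w v c w·c≡0 v∼c))) , v·c≡0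
    c-w : Adj c w
    c-w = vertex-c , vertex-w , (λ c∼w → v·w≢0 (∼-orthogonal v c w v·c≡0 c∼w)) , trans (dot-comm c w) w·c≡0
    shortest : ∀ l → Walk v w l → 2 ≤ l
    shortest zero (here v∼w) = ⊥-elim (v≁w v∼w)
    shortest (suc zero) (step {c′} (_ , _ , _ , v·c′≡0) (here c′∼w)) = ⊥-elim (v·w≢0 (∼-orthogonal v c′ w v·c′≡0 c′∼w))
    shortest (suc (suc _)) _ = s≤s (s≤s z≤n)

  distance-2 : ∀ v w → IsVertex v → IsVertex w → ¬ v ∼ w → ¬ dot v w ≡ 0R → Dist v w 2
  distance-2 v w vertex-v vertex-w v≁w v·w≢0 =
    let (c , vertex-c , v·c≡0 , w·c≡0) = common-zero v w vertex-v
    in distance-2-via v w c vertex-v vertex-w vertex-c v≁w v·w≢0 v·c≡0 w·c≡0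

  distance-≤2 : ∀ v w → IsVertex v → IsVertex w → ∃ λ n → Dist v w n × n ≤ 2
  distance-≤2 v w vertex-v vertex-w with ∼-dec v w | dot v w FinP.≟ 0R
  ... | yes v∼w | _         = 0 , distance-0 v w v∼w , z≤n
  ... | no v≁w  | yes v·w≡0 = 1 , distance-1 v w (vertex-v , vertex-w , v≁w , v·w≡0) , s≤s z≤n
  ... | no v≁w  | no v·w≢0  = 2 , distance-2 v w vertex-v vertex-w v≁w v·w≢0 , ℕP.≤-refl

  -- e₁ and e₁ + e₂ are inequivalent and not orthogonal.
  diameter : Diameter 2
  diameter = distance-≤2 , e₁ , e₁₂ , e₁-vertex , e₁₂-vertex ,
             distance-2 e₁ e₁₂ e₁-vertex e₁₂-vertex e₁≁e₁₂ (1R≢0R ∘ trans (sym (dot-e₁ e₁₂)))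
    where
    e₁₂ : R3
    e₁₂ = 1R , 1R , 0R
    e₁₂-vertex : IsVertex e₁₂
    e₁₂-vertex = unitCoord⇒vertex e₁₂ (inj₁ p∤1)
    e₁≁e₁₂ : ¬ e₁ ∼ e₁₂
    e₁≁e₁₂ (u , _ , eq) = 1R≢0R (trans (sym (cong second eq)) (zeroʳ u))

  -- The vertex count m² + qm + q² in the form of the statement.
  vertex-count-formula :
    p ^ (2 * suc k) + p ^ (2 * suc k ∸ 1) + p ^ (2 * suc k ∸ 2) ≡ m * m + q * (m + q)
  vertex-count-formula = begin
    p ^ (2 * suc k) + p ^ (2 * suc k ∸ 1) + p ^ (2 * suc k ∸ 2)
      ≡⟨ cong₂ _+_ (cong₂ _+_ (split (suc k) (suc k) (cong (suc k +_) (ℕP.+-identityʳ (suc k))))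
                              (split k (suc k) (cong (λ n → k + suc n) (ℕP.+-identityʳ k))))
                   (split k k (trans (cong (λ n → (k + suc n) ∸ 1) (ℕP.+-identityʳ k)) (cong (_∸ 1) (ℕP.+-suc k k)))) ⟩
    m * m + q * m + q * q   ≡⟨ ℕP.+-assoc (m * m) (q * m) (q * q) ⟩
    m * m + (q * m + q * q) ≡⟨ cong (m * m +_) (ℕP.*-distribˡ-+ q m q) ⟨
    m * m + q * (m + q)     ∎
    where
    open ≡-Reasoning
    split : ∀ a b {e} → e ≡ a + b → p ^ e ≡ p ^ a * p ^ b
    split a b refl = ℕP.^-distribˡ-+-* p a b

theorem1 : (p k : ℕ) (pr : Prime p) → 1 ≤ k →
    ZMod.VertexCount (p ^ k) {{pk-nonZero p k pr}} (p ^ (2 * k) + p ^ (2 * k ∸ 1) + p ^ (2 * k ∸ 2))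
    × ZMod.MaxDegree (p ^ k) {{pk-nonZero p k pr}} (p ^ k + p ^ (k ∸ 1))
    × ZMod.Diameter (p ^ k) {{pk-nonZero p k pr}} 2
theorem1 p zero pr ()
theorem1 p (suc k) pr _ =
  subst (ZMod.VertexCount (p ^ suc k)) (sym vertex-count-formula) vertexCount , maxDegree , diameter
  where open PrimePower p k pr
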